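{- Let $\Gamma$ be a formula and let $C=L\cup C'$ be a clause with $L\cap C'=\varnothing$ such that $C$ is a set-blocked clause for $L$ with respect to $\Gamma$. Then for every $p\in L$, the assignment $L\cup\overline{C'}$ (setting every literal of $L$ true and every literal of $C'$ false) satisfies $\mathrm{proj}_{\bar p}(\Gamma)$.
   Context: A literal is a variable $v$ or its negation $\bar v$. A clause is a nontautological set of literals, read as a disjunction; a formula is a finite set of clauses. For a set $L$ of literals, $\bar L=\{\bar\ell:\ell\in L\}$. An assignment is identified with the (consistent) set of literals it makes true; it satisfies a clause if it makes some literal of it true, and a formula if it satisfies all its clauses. A clause $C$ is a set-blocked clause for a nonempty $L\subseteq C$ with respect to $\Gamma$ if for every $D\in\Gamma$ with $D\cap\bar L\neq\varnothing$ and $D\cap L=\varnothing$, the set $(C\setminus L)\cup(D\setminus\bar L)$ is tautological (contains a complementary pair). The projection of $\Gamma$ onto a literal $q$ is $\mathrm{proj}_q(\Gamma)=\{D\setminus\{q\}: D\in\Gamma,\ q\in D\}$. -}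

module Defs where

open import Data.Nat using (ℕ)
open import Data.List using (List; _++_)
open import Data.List.Membership.Propositional using (_∈_; _∉_)
open import Data.Product using (Σ; ∃; _×_; _,_)
open import Data.Sum using (_⊎_)
open import Relation.Nullary using (¬_)
open import Relation.Binary.PropositionalEquality using (_≡_; _≢_)

data Literal : Set where
  pos : ℕ → Literal
  neg : ℕ → Literal

‾ : Literal → Literal
‾ (pos v) = neg v
‾ (neg v) = pos v

-- Finite sets of literals are represented by lists (only membership matters).
LitSet : Set
LitSet = List Literal

TautP : (Literal → Set) → Set
TautP S = ∃ λ ℓ → S ℓ × S (‾ ℓ)

Tautological : LitSet → Set
Tautological S = TautP (λ ℓ → ℓ ∈ S)

IsClause : LitSet → Set
IsClause C = ¬ Tautological C

Formula : Set
Formula = List LitSet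

IsFormula : Formula → Set
IsFormula Γ = ∀ {D} → D ∈ Γ → IsClause D

-- ℓ ∈ L̄  (L̄ = { ‾ ℓ' : ℓ' ∈ L }) iff ‾ ℓ ∈ L
_∈‾_ : Literal → LitSet → Set
ℓ ∈‾ L = ‾ ℓ ∈ L

SetBlocked : LitSet → LitSet → Formula → Set
SetBlocked C L Γ =
  (∃ λ ℓ → ℓ ∈ L) ×
  (∀ {ℓ} → ℓ ∈ L → ℓ ∈ C) ×
  (∀ {D} → D ∈ Γ
         → (∃ λ ℓ → ℓ ∈ D × ℓ ∈‾ L)
         → (∀ {ℓ} → ℓ ∈ D → ℓ ∉ L)
         → TautP (λ ℓ → (ℓ ∈ C × ℓ ∉ L) ⊎ (ℓ ∈ D × ¬ (ℓ ∈‾ L))))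
           -- (C ∖ L) ∪ (D ∖ L̄) is tautological

-- Assignments as (predicate-described) sets of true literals.
Assignment : Set₁
Assignment = Literal → Set

SatisfiesP : Assignment → (Literal → Set) → Set
SatisfiesP τ E = ∃ λ ℓ → E ℓ × τ ℓ

-- τ satisfies proj_q(Γ) = { D ∖ {q} : D ∈ Γ, q ∈ D }
SatisfiesProj : Assignment → Literal → Formula → Set
SatisfiesProj τ q Γ =
  ∀ {D} → D ∈ Γ → q ∈ D → SatisfiesP τ (λ ℓ → ℓ ∈ D × ℓ ≢ q)

assignLC : LitSet → LitSet → Assignment
assignLC L C' ℓ = ℓ ∈ L ⊎ ℓ ∈‾ C'

-- Take a clause D ∈ Γ containing p̄. If D meets L, a literal of L other than p̄ (C contains p, so
-- p̄ ∉ L) satisfies D ∖ {p̄}. Otherwise D is one of the clauses the set-blocking condition speaks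
-- about, so (C ∖ L) ∪ (D ∖ L̄) contains a complementary pair. As C and D are not tautological, the
-- pair must straddle the two parts: some m ∈ D ∖ L̄ has m̄ ∈ C ∖ L = C', so m is true and m ≠ p̄.
module Submission where

open import Defs
import Data.Nat as ℕ
open import Data.List using (_++_)
open import Data.List.Membership.Propositional using (_∈_; _∉_; find; lose)
open import Data.List.Membership.Propositional.Properties using (∈-++⁻; ∈-++⁺ˡ)
open import Data.List.Relation.Unary.Any using (any?)
open import Data.Product using (∃; _×_; _,_; proj₁)
open import Data.Sum using (_⊎_; inj₁; inj₂)
open import Data.Empty using (⊥-elim)
open import Function using (_∘_)
open import Relation.Nullary using (¬_; yes; no)
open import Relation.Nullary.Decidable using (map′)
open import Relation.Binary.Definitions using (DecidableEquality)
open import Relation.Binary.PropositionalEquality using (_≡_; _≢_; refl; sym; cong; subst)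

‾-involutive : ∀ ℓ → ‾ (‾ ℓ) ≡ ℓ
‾-involutive (pos v) = refl
‾-involutive (neg v) = refl

∈⇒‾∈‾ : ∀ {ℓ L} → ℓ ∈ L → ‾ ℓ ∈‾ L
∈⇒‾∈‾ {ℓ} {L} = subst (_∈ L) (sym (‾-involutive ℓ))

_≟_ : DecidableEquality Literal
pos x ≟ pos y = map′ (cong pos) (λ { refl → refl }) (x ℕ.≟ y)
neg x ≟ neg y = map′ (cong neg) (λ { refl → refl }) (x ℕ.≟ y)
pos x ≟ neg y = no λ ()
neg x ≟ pos y = no λ ()

open import Data.List.Membership.DecPropositional _≟_ using (_∈?_)

TautP-mono : {A B : Literal → Set} → (∀ {ℓ} → A ℓ → B ℓ) → TautP A → TautP B
TautP-mono A⊆B (ℓ , aℓ , aℓ‾) = ℓ , A⊆B aℓ , A⊆B aℓ‾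

TautP-⊎-straddles : {A B : Literal → Set} → ¬ TautP A → ¬ TautP B
                  → TautP (λ ℓ → A ℓ ⊎ B ℓ) → ∃ λ m → B m × A (‾ m)
TautP-⊎-straddles ¬A ¬B (ℓ , inj₁ aℓ , inj₁ aℓ‾) = ⊥-elim (¬A (ℓ , aℓ , aℓ‾))
TautP-⊎-straddles ¬A ¬B (ℓ , inj₂ bℓ , inj₂ bℓ‾) = ⊥-elim (¬B (ℓ , bℓ , bℓ‾))
TautP-⊎-straddles ¬A ¬B (ℓ , inj₂ bℓ , inj₁ aℓ‾) = ℓ , bℓ , aℓ‾
TautP-⊎-straddles {A} ¬A ¬B (ℓ , inj₁ aℓ , inj₂ bℓ‾) =
  ‾ ℓ , bℓ‾ , subst A (sym (‾-involutive ℓ)) aℓ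

meets-or-disjoint : (D L : LitSet) → (∃ λ ℓ → ℓ ∈ D × ℓ ∈ L) ⊎ (∀ {ℓ} → ℓ ∈ D → ℓ ∉ L)
meets-or-disjoint D L with any? (_∈? L) D
... | yes D∩L = inj₁ (find D∩L)
... | no D∩L=∅ = inj₂ λ ℓ∈D ℓ∈L → D∩L=∅ (lose ℓ∈D ℓ∈L)

∈-++-∉ˡ : ∀ {ℓ} (L C' : LitSet) → ℓ ∈ L ++ C' → ℓ ∉ L → ℓ ∈ C'
∈-++-∉ˡ L C' ℓ∈L++C' ℓ∉L with ∈-++⁻ L ℓ∈L++C'
... | inj₁ ℓ∈L  = ⊥-elim (ℓ∉L ℓ∈L)
... | inj₂ ℓ∈C' = ℓ∈C'

lemma22 : (Γ : Formula) (L C' : LitSet)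
            → IsFormula Γ
            → IsClause (L ++ C')
            → (∀ {ℓ} → ℓ ∈ L → ℓ ∉ C')
            → SetBlocked (L ++ C') L Γ
            → ∀ {p} → p ∈ L
            → SatisfiesProj (assignLC L C') (‾ p) Γ
lemma22 Γ L C' isFormula isClause _ (_ , _ , blocked) {p} p∈L {D} D∈Γ p‾∈D
  with meets-or-disjoint D L
... | inj₁ (ℓ , ℓ∈D , ℓ∈L) = ℓ , (ℓ∈D , ℓ≢p‾) , inj₁ ℓ∈L
  where
  ℓ≢p‾ : ℓ ≢ ‾ p
  ℓ≢p‾ refl = isClause (p , ∈-++⁺ˡ p∈L , ∈-++⁺ˡ ℓ∈L)
... | inj₂ D∩L=∅
  with TautP-⊎-straddles (isClause ∘ TautP-mono proj₁) (isFormula D∈Γ ∘ TautP-mono proj₁)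
         (blocked D∈Γ (‾ p , p‾∈D , ∈⇒‾∈‾ p∈L) D∩L=∅)
...   | m , (m∈D , m∉L‾) , (m‾∈C , m‾∉L) = m , (m∈D , m≢p‾) , inj₂ (∈-++-∉ˡ L C' m‾∈C m‾∉L)
  where
  m≢p‾ : m ≢ ‾ p
  m≢p‾ refl = m∉L‾ (∈⇒‾∈‾ p∈L)
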